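{- For graphs $A\le^*B$: $A\le^*_sB$ if and only if either $A=B$ or there is $\lambda$ with $(A,B,\lambda)\in\mathcal T$, $\mathbf w_\lambda(A,B)>0$, and $\mathbf w_\lambda(A,A\cup C)>0$ for every nonempty $\lambda$-closed $C\subseteq B\setminus A$ (that is, $\Xi(A,B)\neq\emptyset$).
   Context: Fix an irrational real $\alpha\in(0,1)$. All graphs are finite simple graphs. $A\le^*B$ means $A$ is an induced subgraph of $B$; $A<^*B$ means $A\le^*B$ and $A\ne B$. $\mathcal T$ is the set of triples $(A,B,\lambda)$ with $A\le^*B$ and $\lambda$ an equivalence relation on $B\setminus A$. A set $X\subseteq B$ is $\lambda$-closed if $x\in X\cap(B\setminus A)$ implies $x/\lambda\subseteq X$. For $(A,B,\lambda)\in\mathcal T$: $\mathbf v_\lambda(A,B)=|(B\setminus A)/\lambda|$; $\mathbf e_\lambda(A,B)$ is the number of edges $e$ of $B$ with $e\not\subseteq A$ and $e\not\subseteq x/\lambda$ for every $x\in B\setminus A$; $\mathbf w_\lambda(A,B)=\mathbf v_\lambda(A,B)-\alpha\,\mathbf e_\lambda(A,B)$; for intermediate $\lambda$-closed sets these are computed with the restricted equivalence relation. $\Xi(A,B)$ is the set of $\lambda$ with $(A,B,\lambda)\in\mathcal T$ such that $\mathbf w_\lambda(A,A\cup C)>0$ for every nonempty $\lambda$-closed $C\subseteq B\setminus A$. $A<^*_cB$ means $A<^*B$ and $\mathbf w_\lambda(A,B)<0$ for every $\lambda$ with $(A,B,\lambda)\in\mathcal T$. $A\le^*_iB$ means $A\le^*B$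 and $A'<^*_cB$ for all $A'$ with $A\le^*A'<^*B$; $A<^*_iB$ means $A\le^*_iB$, $A\neq B$. $A\le^*_sB$ means $A\le^*B$ and there is no $A'$ with $A<^*_iA'\le^*B$. -}

module Defs where

open import Data.Bool using (Bool; true; false; _∧_; not; if_then_else_)
open import Data.Nat as ℕ using (ℕ; zero; suc; _<ᵇ_; _≡ᵇ_)
open import Data.Integer using (+_)
open import Data.Fin using (Fin; toℕ)
import Data.Fin as Fin
open import Data.Fin.Subset using (Subset; _∈_; _⊆_; _∪_; Nonempty)
open import Data.Vec using (lookup)
open import Data.Rational using (ℚ; _/_; _*_; _<_; _≤_; 0ℚ; 1ℚ)
open import Data.Product using (Σ; ∃; _×_)
open import Relation.Binary.PropositionalEquality using (_≡_; _≢_)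
open import Relation.Nullary using (¬_)

-- The irrational parameter α ∈ (0,1), given as a Dedekind cut of ℚ
-- with decidable membership and no rational boundary point.
-- below q = true  means  q < α ;  below q = false  means  α < q.

record IrrationalCut : Set where
  field
    below      : ℚ → Bool
    downward   : ∀ p q → p ≤ q → below q ≡ true → below p ≡ true
    noMax      : ∀ q → below q ≡ true → Σ ℚ λ r → (q < r) × (below r ≡ true)
    noMin      : ∀ q → below q ≡ false → Σ ℚ λ r → (r < q) × (below r ≡ false)
    zero-below : below 0ℚ ≡ true
    one-above  : below 1ℚ ≡ false

open IrrationalCut public

ℕtoℚ : ℕ → ℚ
ℕtoℚ n = (+ n) / 1

-- v - α·e > 0
WPos : IrrationalCut → ℕ → ℕ → Set
WPos α v e = Σ ℚ λ q → (below α q ≡ false) × (q * ℕtoℚ e < ℕtoℚ v)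

-- v - α·e < 0
WNeg : IrrationalCut → ℕ → ℕ → Set
WNeg α v e = Σ ℚ λ q → (below α q ≡ true) × (ℕtoℚ v < q * ℕtoℚ e)

record Graph (n : ℕ) : Set where
  field
    adj   : Fin n → Fin n → Bool
    sym   : ∀ x y → adj x y ≡ adj y x
    irref : ∀ x → adj x x ≡ false

open Graph public

count : ∀ {n} → (Fin n → Bool) → ℕ
count {zero}  p = 0
count {suc n} p = (if p Fin.zero then 1 else 0) ℕ.+ count (λ x → p (Fin.suc x))

count2 : ∀ {n m} → (Fin n → Fin m → Bool) → ℕ
count2 {zero}  p = 0
count2 {suc n} p = count (p Fin.zero) ℕ.+ count2 (λ x → p (Fin.suc x))

-- induced subgraphs of G are given by vertex subsets; A ≤* X is A ⊆ X.
_<*_ : ∀ {n} → Subset n → Subset n → Set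
A <* X = (A ⊆ X) × (A ≢ X)

inDiff : ∀ {n} → Subset n → Subset n → Fin n → Bool
inDiff A X x = lookup X x ∧ not (lookup A x)

IsEquivOn : ∀ {n} → Subset n → Subset n → (Fin n → Fin n → Bool) → Set
IsEquivOn A X R =
  (∀ x → inDiff A X x ≡ true → R x x ≡ true) ×
  (∀ x y → inDiff A X x ≡ true → inDiff A X y ≡ true → R x y ≡ true → R y x ≡ true) ×
  (∀ x y z → inDiff A X x ≡ true → inDiff A X y ≡ true → inDiff A X z ≡ true →
     R x y ≡ true → R y z ≡ true → R x z ≡ true)

InT : ∀ {n} → Subset n → Subset n → (Fin n → Fin n → Bool) → Set
InT A X R = (A ⊆ X) × IsEquivOn A X R

-- v_λ(A,X): number of λ-classes of X \ A, counted via least (in Fin order) representatives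
vW : ∀ {n} → Subset n → Subset n → (Fin n → Fin n → Bool) → ℕ
vW A X R = count (λ x → inDiff A X x ∧
  (count (λ y → inDiff A X y ∧ R y x ∧ (toℕ y <ᵇ toℕ x)) ≡ᵇ 0))

-- e_λ(A,X): edges {x,y} of X (counted once, toℕ x < toℕ y) not inside A
-- and not inside a single λ-class
eW : ∀ {n} → Graph n → Subset n → Subset n → (Fin n → Fin n → Bool) → ℕ
eW G A X R = count2 (λ x y →
  (toℕ x <ᵇ toℕ y) ∧ adj G x y ∧ lookup X x ∧ lookup X y ∧
  not (lookup A x ∧ lookup A y) ∧
  not (inDiff A X x ∧ inDiff A X y ∧ R x y))

wPos : ∀ {n} → IrrationalCut → Graph n → Subset n → Subset n → (Fin n → Fin n → Bool) → Set
wPos α G A X R = WPos α (vW A X R) (eW G A X R)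

wNeg : ∀ {n} → IrrationalCut → Graph n → Subset n → Subset n → (Fin n → Fin n → Bool) → Set
wNeg α G A X R = WNeg α (vW A X R) (eW G A X R)

ClosedNonempty : ∀ {n} → Subset n → Subset n → (Fin n → Fin n → Bool) → Subset n → Set
ClosedNonempty A X R C =
  Nonempty C ×
  (∀ x → x ∈ C → inDiff A X x ≡ true) ×
  (∀ x y → x ∈ C → inDiff A X y ≡ true → R x y ≡ true → y ∈ C)

InXi : ∀ {n} → IrrationalCut → Graph n → Subset n → Subset n → (Fin n → Fin n → Bool) → Set
InXi α G A X R = InT A X R ×
  (∀ C → ClosedNonempty A X R C → wPos α G A (A ∪ C) R)

_⊢_<c_ : ∀ {n} → IrrationalCut × Graph n → Subset n → Subset n → Set
(α Data.Product., G) ⊢ A <c X =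
  (A <* X) × (∀ R → InT A X R → wNeg α G A X R)

_⊢_≤i_ : ∀ {n} → IrrationalCut × Graph n → Subset n → Subset n → Set
P ⊢ A ≤i X = (A ⊆ X) × (∀ A' → A ⊆ A' → A' <* X → P ⊢ A' <c X)

_⊢_<i_ : ∀ {n} → IrrationalCut × Graph n → Subset n → Subset n → Set
P ⊢ A <i X = (P ⊢ A ≤i X) × (A ≢ X)

_⊢_≤s_ : ∀ {n} → IrrationalCut × Graph n → Subset n → Subset n → Set
P ⊢ A ≤s X = (A ⊆ X) × ¬ (Σ (Subset _) λ A' → (P ⊢ A <i A') × (A' ⊆ X))

{-# OPTIONS --safe #-}
-- Only finitely many pairs (v , e) of vertex and edge counts occur in G and α is irrational, so a
-- rational a/d just below α gives v − αe the sign of d·v − a·e for all of them: every weight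
-- comparison becomes one in ℕ.  Weights add along A ⊆ M ⊆ B as soon as M∖A is a union of
-- λ-classes, and relations on M∖A and on B∖M glue to one on B∖A whose weight is the sum.
--
-- (⇐) Given λ ∈ Ξ(A,B) and A <ᵢ A′, let C be the λ-saturation of A′∖A.  Passing from A′ to A ∪ C
-- adds edges but no classes, so 0 < w_λ(A , A ∪ C) ≤ w_λ(A , A′) < 0.
-- (⇒) If A ≤ₛ B then A has no closed extension: at a smallest A <c Y the intrinsic test fails at
-- some A′ with w(A′ , Y) > 0, and either A <c A′ is smaller, or a positive relation on A′∖A glues
-- to a positive one on Y∖A.  Hence some λ has w_λ(A , B) > 0; take one of maximal weight.  Were
-- w_λ(A , A ∪ C) < 0 for a closed C, gluing a positive relation on C to λ outside C would weigh
-- more.  Both extremal choices are descents inside ¬¬; the witness λ is then recovered by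
-- exhaustive search, all conditions being decidable.
module Submission where

open import Defs hiding (sym)
open import Data.Bool as Bool using (Bool; true; false; _∧_; _∨_; not; if_then_else_)
open import Data.Bool.Properties using (∧-assoc; ∧-zeroʳ; T-≡)
open import Data.Empty using (⊥-elim)
open import Data.Fin as Fin using (Fin; toℕ)
import Data.Fin.Properties as Fin
open import Data.Fin.Subset using (Subset; _∈_; _⊆_; _⊂_; _∪_; ⊤; ∣_∣)
import Data.Fin.Subset.Properties as Subset
open import Data.Integer as ℤ using (+_; -[1+_]; +<+)
import Data.Integer.Properties as ℤ
open import Data.List using (List; []; _∷_; upTo; cartesianProductWith)
open import Data.List.Membership.Propositional using () renaming (_∈_ to _∈ˡ_)
open import Data.List.Membership.Propositional.Properties using (∈-cartesianProductWith⁺; ∈-upTo⁺)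
open import Data.List.Relation.Unary.All as All using (All; []; _∷_)
open import Data.Nat as ℕ using (ℕ; zero; suc; _+_; _*_; _∸_; _≤_; _<_; z≤n; s≤s; _<ᵇ_; _≡ᵇ_)
import Data.Nat.Properties as ℕ
open import Algebra.Properties.CommutativeSemigroup ℕ.+-commutativeSemigroup using (interchange)
open import Data.Nat.Coprimality as Coprime using (Coprime; 1-coprimeTo)
open import Data.Nat.Induction using (<-wellFounded)
open import Data.Product using (Σ; ∃; _×_; _,_; proj₁; proj₂)
open import Data.Rational as ℚ using (ℚ; mkℚ; 0ℚ; 1ℚ; toℚᵘ)
import Data.Rational.Properties as ℚ
open import Data.Rational.Unnormalised as ℚᵘ using (mkℚᵘ; *<*; _≃_)
import Data.Rational.Unnormalised.Properties as ℚᵘ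
open import Data.Sum using (_⊎_; inj₁; inj₂)
open import Data.Vec using (Vec; []; _∷_; lookup; tabulate)
import Data.Vec.Properties as Vec
open import Effect.Monad using (RawMonad)
open import Function using (_∘_; _⇔_; mk⇔; Equivalence)
open import Induction.WellFounded as WF using ()
open import Level using (0ℓ)
import Relation.Binary.Construct.On as On
open import Relation.Binary.PropositionalEquality
open import Relation.Nullary using (¬_; ¬?; Dec; Stable; does; yes; no; contradiction)
open import Relation.Nullary.Decidable
  using (⌊_⌋; map′; decidable-stable; toWitness; fromWitness; _×-dec_; _→-dec_)
open import Relation.Nullary.Negation using (¬¬-Monad; ¬¬-map; negated-stable)
open import Relation.Unary using (Decidable)

open Equivalence
open RawMonad (¬¬-Monad {0ℓ}) using (_>>=_; pure)

private variable
  n m : ℕ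
  x : Fin n
  A M B X : Subset n
  p q r : Fin n → Bool
  P Q S : Fin n → Fin m → Bool

ind : Bool → ℕ
ind b = if b then 1 else 0

count-cong : (∀ x → p x ≡ q x) → count p ≡ count q
count-cong {zero}  p≡q = refl
count-cong {suc n} p≡q = cong₂ _+_ (cong ind (p≡q Fin.zero)) (count-cong (p≡q ∘ Fin.suc))

count-split : (∀ x → ind (p x) ≡ ind (q x) + ind (r x)) → count p ≡ count q + count r
count-split {zero}  split = refl
count-split {suc n} {q = q} {r} split = begin
  _ ≡⟨ cong₂ _+_ (split Fin.zero) (count-split (split ∘ Fin.suc)) ⟩
  _ ≡⟨ interchange (ind (q Fin.zero)) (ind (r Fin.zero)) (count (q ∘ Fin.suc)) (count (r ∘ Fin.suc)) ⟩
  _ ∎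
  where open ≡-Reasoning

count-mono : (∀ x → p x ≡ true → q x ≡ true) → count p ≤ count q
count-mono {zero}  p⇒q = z≤n
count-mono {suc n} p⇒q = ℕ.+-mono-≤ (ind-mono (p⇒q Fin.zero)) (count-mono (p⇒q ∘ Fin.suc))
  where
  ind-mono : ∀ {b c} → (b ≡ true → c ≡ true) → ind b ≤ ind c
  ind-mono {false} _   = z≤n
  ind-mono {true}  b⇒c rewrite b⇒c refl = ℕ.≤-refl

count≤n : (p : Fin n → Bool) → count p ≤ n
count≤n {zero}  p = z≤n
count≤n {suc n} p = ℕ.+-mono-≤ (ind≤1 (p Fin.zero)) (count≤n (p ∘ Fin.suc))
  where
  ind≤1 : ∀ b → ind b ≤ 1
  ind≤1 false = z≤n
  ind≤1 true  = ℕ.≤-refl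

count≡0 : (∀ x → p x ≡ false) → count p ≡ 0
count≡0 {zero}  none = refl
count≡0 {suc n} none rewrite none Fin.zero = count≡0 (none ∘ Fin.suc)

count≡0⁻¹ : ∀ (p : Fin n → Bool) → count p ≡ 0 → ∀ x → p x ≡ false
count≡0⁻¹ {suc n} p c≡0 x with p Fin.zero in p0
count≡0⁻¹ {suc n} p c≡0 Fin.zero    | false = p0
count≡0⁻¹ {suc n} p c≡0 (Fin.suc x) | false = count≡0⁻¹ (p ∘ Fin.suc) c≡0 x

count>0 : ∀ (p : Fin n → Bool) x → p x ≡ true → 0 < count p
count>0 p x px = ℕ.n≢0⇒n>0 λ c≡0 → contradiction (trans (sym (count≡0⁻¹ p c≡0 x)) px) λ ()

count-witness : ∀ (p : Fin n → Bool) {k} → count p ≡ suc k → ∃ λ x → p x ≡ true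
count-witness {suc n} p c≡ with p Fin.zero in p0
... | true  = Fin.zero , p0
... | false = let x , px = count-witness (p ∘ Fin.suc) c≡ in Fin.suc x , px

_─_ : (Fin n → Bool) → Fin n → Fin n → Bool
(p ─ x) y = p y ∧ not (does (y Fin.≟ x))

count-─ : ∀ (p : Fin n → Bool) x → p x ≡ true → count p ≡ suc (count (p ─ x))
count-─ p x px = trans (count-split pointwise) (cong (_+ count (p ─ x)) (count-singleton x))
  where
  pointwise : ∀ y → ind (p y) ≡ ind (does (y Fin.≟ x)) + ind ((p ─ x) y)
  pointwise y with y Fin.≟ x
  ... | yes refl rewrite px = refl
  ... | no  _ with p y
  ...   | true  = refl
  ...   | false = refl
  count-singleton : ∀ {n} (x : Fin n) → count (λ y → does (y Fin.≟ x)) ≡ 1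
  count-singleton {suc n} Fin.zero    = cong suc (count≡0 {n} λ _ → refl)
  count-singleton {suc n} (Fin.suc x) = count-singleton x

─-intro : ∀ (p : Fin n → Bool) {x} y → p y ≡ true → y ≢ x → (p ─ x) y ≡ true
─-intro p {x} y py y≢x with y Fin.≟ x
... | yes y≡x = contradiction y≡x y≢x
... | no  _   rewrite py = refl

─-elim : ∀ (p : Fin n → Bool) x y → (p ─ x) y ≡ true → p y ≡ true × y ≢ x
─-elim p x y p─x with p y | y Fin.≟ x
... | true | no y≢x = refl , y≢x

count-injection : (f : Fin n → Fin n) → (∀ x → p x ≡ true → q (f x) ≡ true) →
  (∀ x y → p x ≡ true → p y ≡ true → f x ≡ f y → x ≡ y) → count p ≤ count q
count-injection f = go refl
  where
  go : ∀ {k p q} → count p ≡ k → (∀ x → p x ≡ true → q (f x) ≡ true) →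
       (∀ x y → p x ≡ true → p y ≡ true → f x ≡ f y → x ≡ y) → count p ≤ count q
  go {zero}          c≡0 maps inj = ℕ.≤-trans (ℕ.≤-reflexive c≡0) z≤n
  go {suc k} {p} {q} c≡  maps inj = begin
    count p                  ≡⟨ count-─ p x₀ px₀ ⟩
    suc (count (p ─ x₀))     ≤⟨ s≤s (go (ℕ.suc-injective (trans (sym (count-─ p x₀ px₀)) c≡)) maps─ inj─) ⟩
    suc (count (q ─ f x₀))   ≡⟨ count-─ q (f x₀) (maps x₀ px₀) ⟨
    count q                  ∎
    where
    open ℕ.≤-Reasoning
    x₀ : Fin _
    x₀ = proj₁ (count-witness p c≡)
    px₀ : p x₀ ≡ true
    px₀ = proj₂ (count-witness p c≡)
    maps─ : ∀ y → (p ─ x₀) y ≡ true → (q ─ f x₀) (f y) ≡ true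
    maps─ y p─xy = let py , y≢x₀ = ─-elim p x₀ y p─xy in
      ─-intro q (f y) (maps y py) (y≢x₀ ∘ inj y x₀ py px₀)
    inj─ : ∀ y z → (p ─ x₀) y ≡ true → (p ─ x₀) z ≡ true → f y ≡ f z → y ≡ z
    inj─ y z p─xy p─xz = inj y z (proj₁ (─-elim p x₀ y p─xy)) (proj₁ (─-elim p x₀ z p─xz))

count2-cong : (∀ x y → P x y ≡ Q x y) → count2 P ≡ count2 Q
count2-cong {zero}  P≡Q = refl
count2-cong {suc n} P≡Q = cong₂ _+_ (count-cong (P≡Q Fin.zero)) (count2-cong (P≡Q ∘ Fin.suc))

count2-split : (∀ x y → ind (P x y) ≡ ind (Q x y) + ind (S x y)) → count2 P ≡ count2 Q + count2 S
count2-split {zero}  split = refl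
count2-split {suc n} {Q = Q} {S} split = begin
  _ ≡⟨ cong₂ _+_ (count-split (split Fin.zero)) (count2-split (split ∘ Fin.suc)) ⟩
  _ ≡⟨ interchange (count (Q Fin.zero)) (count (S Fin.zero)) (count2 (Q ∘ Fin.suc)) (count2 (S ∘ Fin.suc)) ⟩
  _ ∎
  where open ≡-Reasoning

count2-mono : (∀ x y → P x y ≡ true → Q x y ≡ true) → count2 P ≤ count2 Q
count2-mono {zero}  P⇒Q = z≤n
count2-mono {suc n} P⇒Q = ℕ.+-mono-≤ (count-mono (P⇒Q Fin.zero)) (count2-mono (P⇒Q ∘ Fin.suc))

count2≤n*m : (P : Fin n → Fin m → Bool) → count2 P ≤ n * m
count2≤n*m {zero}  P = z≤n
count2≤n*m {suc n} P = ℕ.+-mono-≤ (count≤n (P Fin.zero)) (count2≤n*m (P ∘ Fin.suc))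

-- Additivity along a chain A ⊆ M ⊆ B

∧-intro : ∀ {a b} → a ≡ true → b ≡ true → a ∧ b ≡ true
∧-intro refl refl = refl

∧-elim : ∀ a {b} → a ∧ b ≡ true → a ≡ true × b ≡ true
∧-elim true refl = refl , refl

∧-congˡ-if : ∀ a {b b′} → (a ≡ true → b ≡ b′) → a ∧ b ≡ a ∧ b′
∧-congˡ-if false _ = refl
∧-congˡ-if true  h = h refl

∧-congʳ-if : ∀ {a a′} b → (b ≡ true → a ≡ a′) → a ∧ b ≡ a′ ∧ b
∧-congʳ-if {a} {a′} false _ = trans (∧-zeroʳ a) (sym (∧-zeroʳ a′))
∧-congʳ-if          true  h = cong (_∧ true) (h refl)

ind-∧-split : ∀ a {b c d} → ind b ≡ ind c + ind d → ind (a ∧ b) ≡ ind (a ∧ c) + ind (a ∧ d)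
ind-∧-split false _     = refl
ind-∧-split true  split = split

BoolRel : ℕ → Set
BoolRel n = Fin n → Fin n → Bool

∈⇒lookup : x ∈ X → lookup X x ≡ true
∈⇒lookup = Vec.[]=⇒lookup

lookup⇒∈ : lookup X x ≡ true → x ∈ X
lookup⇒∈ = Vec.lookup⇒[]= _ _

⊆-lookup : A ⊆ X → lookup A x ≡ true → lookup X x ≡ true
⊆-lookup A⊆X = ∈⇒lookup ∘ A⊆X ∘ lookup⇒∈

⊆-lookup-false : A ⊆ X → lookup X x ≡ false → lookup A x ≡ false
⊆-lookup-false {A = A} {x = x} A⊆X x∉X with lookup A x in x∈A
... | false = refl
... | true  = contradiction (trans (sym x∉X) (⊆-lookup A⊆X x∈A)) λ ()

lookup-⊤ : ∀ (x : Fin n) → lookup ⊤ x ≡ true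
lookup-⊤ x = Vec.lookup-replicate x true

lookup-∪ : ∀ (A C : Subset n) x → lookup A x ≡ false → lookup (A ∪ C) x ≡ lookup C x
lookup-∪ A C x x∉A rewrite Vec.lookup-zipWith _∨_ x A C | x∉A = refl

∖-intro : ∀ A X {x : Fin n} → lookup X x ≡ true → lookup A x ≡ false → inDiff A X x ≡ true
∖-intro A X x∈X x∉A rewrite x∈X | x∉A = refl

∖-elim : ∀ A X (x : Fin n) → inDiff A X x ≡ true → lookup X x ≡ true × lookup A x ≡ false
∖-elim A X x x∈X∖A with lookup X x | lookup A x
... | true | false = refl , refl

∖-monoʳ : ∀ A → X ⊆ B → ∀ x → inDiff A X x ≡ true → inDiff A B x ≡ true
∖-monoʳ {X = X} {B} A X⊆B x x∈ = let x∈X , x∉A = ∖-elim A X x x∈ in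
  ∖-intro A B (⊆-lookup X⊆B x∈X) x∉A

∖-antitoneˡ : ∀ X → A ⊆ M → ∀ x → inDiff M X x ≡ true → inDiff A X x ≡ true
∖-antitoneˡ {A = A} {M} X A⊆M x x∈ = let x∈X , x∉M = ∖-elim M X x x∈ in
  ∖-intro A X x∈X (⊆-lookup-false A⊆M x∉M)

∖⊆⊤∖ : ∀ A X (x : Fin n) → inDiff A X x ≡ true → inDiff A ⊤ x ≡ true
∖⊆⊤∖ A X x x∈ = ∖-intro A ⊤ (lookup-⊤ x) (proj₂ (∖-elim A X x x∈))

∖-nonempty⇒≢ : ∀ {A X} (x : Fin n) → inDiff A X x ≡ true → A ≢ X
∖-nonempty⇒≢ {A = A} x x∈ refl with lookup A x
∖-nonempty⇒≢ x () refl | true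
∖-nonempty⇒≢ x () refl | false

data Layer : Bool → Bool → Bool → Set where
  inA   : Layer true  true  true
  inM∖A : Layer false true  true
  inB∖M : Layer false false true
  outB  : Layer false false false

layer : A ⊆ M → M ⊆ B → ∀ x → Layer (lookup A x) (lookup M x) (lookup B x)
layer {A = A} {M} {B} A⊆M M⊆B x with lookup A x in a | lookup M x in m | lookup B x in b
... | true  | true  | true  = inA
... | false | true  | true  = inM∖A
... | false | false | true  = inB∖M
... | false | false | false = outB
... | true  | false | _     = contradiction (trans (sym m) (⊆-lookup A⊆M a)) λ ()
... | _     | true  | false = contradiction (trans (sym b) (⊆-lookup M⊆B m)) λ ()

-- eW G A X R counts the pairs x < y of G-neighbours with edgeIn (A x) (X x) (A y) (X y) (R x y).
edgeIn : Bool → Bool → Bool → Bool → Bool → Bool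
edgeIn a₁ x₁ a₂ x₂ r = x₁ ∧ x₂ ∧ not (a₁ ∧ a₂) ∧ not ((x₁ ∧ not a₁) ∧ (x₂ ∧ not a₂) ∧ r)

edgeIn-split : ∀ {ax mx bx ay my by} r → Layer ax mx bx → Layer ay my by →
  (bx ∧ not ax ≡ true → by ∧ not ay ≡ true → r ≡ true → mx ≡ my) →
  ind (edgeIn ax bx ay by r) ≡ ind (edgeIn ax mx ay my r) + ind (edgeIn mx bx my by r)
edgeIn-split r     inA   inA   _   = refl
edgeIn-split r     inA   inM∖A _   = refl
edgeIn-split r     inA   inB∖M _   = refl
edgeIn-split r     inA   outB  _   = refl
edgeIn-split r     inM∖A inA   _   = refl
edgeIn-split false inM∖A inM∖A _   = refl
edgeIn-split true  inM∖A inM∖A _   = refl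
edgeIn-split false inM∖A inB∖M _   = refl
edgeIn-split true  inM∖A inB∖M cut = contradiction (cut refl refl refl) λ ()
edgeIn-split r     inM∖A outB  _   = refl
edgeIn-split r     inB∖M inA   _   = refl
edgeIn-split false inB∖M inM∖A _   = refl
edgeIn-split true  inB∖M inM∖A cut = contradiction (cut refl refl refl) λ ()
edgeIn-split r     inB∖M inB∖M _   = refl
edgeIn-split r     inB∖M outB  _   = refl
edgeIn-split r     outB  _     _   = refl

edgeIn-mono : ∀ {a₁ a₂ x₁ x₂ y₁ y₂ r} → (x₁ ≡ true → y₁ ≡ true) → (x₂ ≡ true → y₂ ≡ true) →
  edgeIn a₁ x₁ a₂ x₂ r ≡ true → edgeIn a₁ y₁ a₂ y₂ r ≡ true
edgeIn-mono {x₁ = true} {true} x₁⇒y₁ x₂⇒y₂ e rewrite x₁⇒y₁ refl | x₂⇒y₂ refl = e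

-- vW A X R counts the x with classRep A X R x.
leastInClass : (Fin n → Bool) → BoolRel n → Fin n → Bool
leastInClass D R x = count (λ y → D y ∧ R y x ∧ (toℕ y <ᵇ toℕ x)) ≡ᵇ 0

classRep : Subset n → Subset n → BoolRel n → Fin n → Bool
classRep A X R x = inDiff A X x ∧ leastInClass (inDiff A X) R x

leastInClass-cong : ∀ (D D′ : Fin n → Bool) (R R′ : BoolRel n) x →
  (∀ y → D y ∧ R y x ≡ D′ y ∧ R′ y x) → leastInClass D R x ≡ leastInClass D′ R′ x
leastInClass-cong D D′ R R′ x same = cong (_≡ᵇ 0) (count-cong λ y → begin
  D y ∧ R y x ∧ (toℕ y <ᵇ toℕ x)     ≡⟨ ∧-assoc (D y) (R y x) _ ⟨
  (D y ∧ R y x) ∧ (toℕ y <ᵇ toℕ x)   ≡⟨ cong (_∧ (toℕ y <ᵇ toℕ x)) (same y) ⟩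
  (D′ y ∧ R′ y x) ∧ (toℕ y <ᵇ toℕ x) ≡⟨ ∧-assoc (D′ y) (R′ y x) _ ⟩
  D′ y ∧ R′ y x ∧ (toℕ y <ᵇ toℕ x)   ∎)
  where open ≡-Reasoning

vertexIn-split : ∀ {a m b l l′ l″} → Layer a m b →
  (m ∧ not a ≡ true → l ≡ l′) → (b ∧ not m ≡ true → l ≡ l″) →
  ind ((b ∧ not a) ∧ l) ≡ ind ((m ∧ not a) ∧ l′) + ind ((b ∧ not m) ∧ l″)
vertexIn-split inA   _ _ = refl
vertexIn-split {l′ = l′} inM∖A same _ rewrite same refl = sym (ℕ.+-identityʳ (ind l′))
vertexIn-split inB∖M _ same = cong ind (same refl)
vertexIn-split outB  _ _ = refl

∖-narrowᴹ : ∀ {a m b} → Layer a m b → (b ∧ not a ≡ true → m ≡ true) → b ∧ not a ≡ m ∧ not a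
∖-narrowᴹ inA   _    = refl
∖-narrowᴹ inM∖A _    = refl
∖-narrowᴹ inB∖M into = contradiction (into refl) λ ()
∖-narrowᴹ outB  _    = refl

∖-narrowᴮ : ∀ {a m b} → Layer a m b → (b ∧ not a ≡ true → m ≡ false) → b ∧ not a ≡ b ∧ not m
∖-narrowᴮ inA   _     = refl
∖-narrowᴮ inM∖A outof = contradiction (outof refl) λ ()
∖-narrowᴮ inB∖M _     = refl
∖-narrowᴮ outB  _     = refl

UnionOfClasses : Subset n → Subset n → Subset n → BoolRel n → Set
UnionOfClasses A M B R =
  ∀ x y → inDiff A B x ≡ true → inDiff A B y ≡ true → R x y ≡ true → lookup M x ≡ lookup M y

module _ {A M B : Subset n} (A⊆M : A ⊆ M) (M⊆B : M ⊆ B) {R : BoolRel n}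
         (union : UnionOfClasses A M B R) where

  vW-split : vW A B R ≡ vW A M R + vW M B R
  vW-split = count-split λ x → vertexIn-split (layer A⊆M M⊆B x) (inner x) (outer x)
    where
    inner : ∀ x → inDiff A M x ≡ true →
      leastInClass (inDiff A B) R x ≡ leastInClass (inDiff A M) R x
    inner x x∈ = leastInClass-cong (inDiff A B) (inDiff A M) R R x λ y → ∧-congʳ-if (R y x) λ Ryx →
      ∖-narrowᴹ (layer A⊆M M⊆B y) λ y∈ →
        trans (union y x y∈ (∖-monoʳ A M⊆B x x∈) Ryx) (proj₁ (∖-elim A M x x∈))
    outer : ∀ x → inDiff M B x ≡ true →
      leastInClass (inDiff A B) R x ≡ leastInClass (inDiff M B) R x
    outer x x∈ = leastInClass-cong (inDiff A B) (inDiff M B) R R x λ y → ∧-congʳ-if (R y x) λ Ryx →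
      ∖-narrowᴮ (layer A⊆M M⊆B y) λ y∈ →
        trans (union y x y∈ (∖-antitoneˡ B A⊆M x x∈) Ryx) (proj₂ (∖-elim M B x x∈))

  eW-split : ∀ G → eW G A B R ≡ eW G A M R + eW G M B R
  eW-split G = count2-split λ x y → ind-∧-split (toℕ x <ᵇ toℕ y) (ind-∧-split (adj G x y)
    (edgeIn-split (R x y) (layer A⊆M M⊆B x) (layer A⊆M M⊆B y) (union x y)))

AgreeOn : Subset n → Subset n → BoolRel n → BoolRel n → Set
AgreeOn A X R R′ = ∀ x y → inDiff A X x ≡ true → inDiff A X y ≡ true → R x y ≡ R′ x y

module _ (A X : Subset n) {R R′ : BoolRel n} (agree : AgreeOn A X R R′) where

  vW-cong : vW A X R ≡ vW A X R′
  vW-cong = count-cong λ x → ∧-congˡ-if (inDiff A X x) λ x∈ →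
    leastInClass-cong (inDiff A X) (inDiff A X) R R′ x λ y →
      ∧-congˡ-if (inDiff A X y) λ y∈ → agree y x y∈ x∈

  eW-cong : ∀ G → eW G A X R ≡ eW G A X R′
  eW-cong G = count2-cong λ x y →
    cong (λ r → (toℕ x <ᵇ toℕ y) ∧ adj G x y ∧ lookup X x ∧ lookup X y ∧
                not (lookup A x ∧ lookup A y) ∧ not r)
         (∧-congˡ-if (inDiff A X x) λ x∈ → ∧-congˡ-if (inDiff A X y) λ y∈ → agree x y x∈ y∈)

  IsEquivOn-cong : IsEquivOn A X R → IsEquivOn A X R′
  IsEquivOn-cong (refl₀ , sym₀ , trans₀) =
    (λ x x∈ → trans (sym (agree x x x∈ x∈)) (refl₀ x x∈)) ,
    (λ x y x∈ y∈ r → trans (sym (agree y x y∈ x∈)) (sym₀ x y x∈ y∈ (trans (agree x y x∈ y∈) r))) ,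
    (λ x y z x∈ y∈ z∈ r s → trans (sym (agree x z x∈ z∈))
      (trans₀ x y z x∈ y∈ z∈ (trans (agree x y x∈ y∈) r) (trans (agree y z y∈ z∈) s)))

IsEquivOn-restrict : ∀ {A X A′ X′ : Subset n} {R} →
  (∀ x → inDiff A′ X′ x ≡ true → inDiff A X x ≡ true) → IsEquivOn A X R → IsEquivOn A′ X′ R
IsEquivOn-restrict ⊆ (refl₀ , sym₀ , trans₀) =
  (λ x x∈ → refl₀ x (⊆ x x∈)) ,
  (λ x y x∈ y∈ → sym₀ x y (⊆ x x∈) (⊆ y y∈)) ,
  (λ x y z x∈ y∈ z∈ → trans₀ x y z (⊆ x x∈) (⊆ y y∈) (⊆ z z∈))

IsEquivOn-union : ∀ {A M B : Subset n} {R} → UnionOfClasses A M B R →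
  IsEquivOn A M R → IsEquivOn M B R → IsEquivOn A B R
IsEquivOn-union {A = A} {M} {B} {R} union (refl₀ , sym₀ , trans₀) (refl₁ , sym₁ , trans₁) =
  reflexive , symmetric , transitive
  where
  inner : ∀ x → inDiff A B x ≡ true → lookup M x ≡ true → inDiff A M x ≡ true
  inner x x∈ x∈M = ∖-intro A M x∈M (proj₂ (∖-elim A B x x∈))

  outer : ∀ x → inDiff A B x ≡ true → lookup M x ≡ false → inDiff M B x ≡ true
  outer x x∈ x∉M = ∖-intro M B (proj₁ (∖-elim A B x x∈)) x∉M

  along : ∀ {b} x y → inDiff A B x ≡ true → inDiff A B y ≡ true → R x y ≡ true →
    lookup M x ≡ b → lookup M y ≡ b
  along x y x∈ y∈ r = trans (sym (union x y x∈ y∈ r))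

  reflexive : ∀ x → inDiff A B x ≡ true → R x x ≡ true
  reflexive x x∈ with lookup M x in Mx
  ... | true  = refl₀ x (inner x x∈ Mx)
  ... | false = refl₁ x (outer x x∈ Mx)

  symmetric : ∀ x y → inDiff A B x ≡ true → inDiff A B y ≡ true → R x y ≡ true → R y x ≡ true
  symmetric x y x∈ y∈ r with lookup M x in Mx
  ... | true  = sym₀ x y (inner x x∈ Mx) (inner y y∈ (along x y x∈ y∈ r Mx)) r
  ... | false = sym₁ x y (outer x x∈ Mx) (outer y y∈ (along x y x∈ y∈ r Mx)) r

  transitive : ∀ x y z → inDiff A B x ≡ true → inDiff A B y ≡ true → inDiff A B z ≡ true →
    R x y ≡ true → R y z ≡ true → R x z ≡ true
  transitive x y z x∈ y∈ z∈ r s with lookup M x in Mx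
  ... | true  = trans₀ x y z (inner x x∈ Mx) (inner y y∈ My) (inner z z∈ (along y z y∈ z∈ s My)) r s
    where
    My : lookup M y ≡ true
    My = along x y x∈ y∈ r Mx
  ... | false = trans₁ x y z (outer x x∈ Mx) (outer y y∈ My) (outer z z∈ (along y z y∈ z∈ s My)) r s
    where
    My : lookup M y ≡ false
    My = along x y x∈ y∈ r Mx

glue : Subset n → BoolRel n → BoolRel n → BoolRel n
glue M R₀ R₁ x y = if lookup M x then lookup M y ∧ R₀ x y else not (lookup M y) ∧ R₁ x y

private
  if-cut : ∀ mx my r₀ r₁ → (if mx then my ∧ r₀ else not my ∧ r₁) ≡ true → mx ≡ my
  if-cut true  true  _ _ _ = refl
  if-cut false false _ _ _ = refl

  if-inner : ∀ {mx my} r₀ r₁ → mx ≡ true → my ≡ true → r₀ ≡ (if mx then my ∧ r₀ else not my ∧ r₁)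
  if-inner _ _ refl refl = refl

  if-outer : ∀ {mx my} r₀ r₁ → mx ≡ false → my ≡ false → r₁ ≡ (if mx then my ∧ r₀ else not my ∧ r₁)
  if-outer _ _ refl refl = refl

module _ {A M B : Subset n} {R₀ R₁ : BoolRel n} where

  glue-union : UnionOfClasses A M B (glue M R₀ R₁)
  glue-union x y _ _ = if-cut (lookup M x) (lookup M y) (R₀ x y) (R₁ x y)

  glue-agreeᴹ : AgreeOn A M R₀ (glue M R₀ R₁)
  glue-agreeᴹ x y x∈ y∈ =
    if-inner (R₀ x y) (R₁ x y) (proj₁ (∖-elim A M x x∈)) (proj₁ (∖-elim A M y y∈))

  glue-agreeᴮ : AgreeOn M B R₁ (glue M R₀ R₁)
  glue-agreeᴮ x y x∈ y∈ =
    if-outer (R₀ x y) (R₁ x y) (proj₂ (∖-elim M B x x∈)) (proj₂ (∖-elim M B y y∈))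

  glue-isEquiv : IsEquivOn A M R₀ → IsEquivOn M B R₁ → IsEquivOn A B (glue M R₀ R₁)
  glue-isEquiv equiv₀ equiv₁ = IsEquivOn-union {A = A} {M} {B} glue-union
    (IsEquivOn-cong A M glue-agreeᴹ equiv₀) (IsEquivOn-cong M B glue-agreeᴮ equiv₁)

  module _ (A⊆M : A ⊆ M) (M⊆B : M ⊆ B) where

    vW-glue : vW A B (glue M R₀ R₁) ≡ vW A M R₀ + vW M B R₁
    vW-glue = trans (vW-split A⊆M M⊆B glue-union)
                    (sym (cong₂ _+_ (vW-cong A M glue-agreeᴹ) (vW-cong M B glue-agreeᴮ)))

    eW-glue : ∀ G → eW G A B (glue M R₀ R₁) ≡ eW G A M R₀ + eW G M B R₁
    eW-glue G = trans (eW-split A⊆M M⊆B glue-union G)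
                      (sym (cong₂ _+_ (eW-cong A M glue-agreeᴹ G) (eW-cong M B glue-agreeᴮ G)))

Least : (Fin n → Bool) → Fin n → Set
Least p x = p x ≡ true × (∀ y → y Fin.< x → p y ≡ false)

least? : (p : Fin n → Bool) → (∀ x → p x ≡ false) ⊎ ∃ (Least p)
least? {zero}  p = inj₁ λ ()
least? {suc n} p with p Fin.zero in p0
... | true  = inj₂ (Fin.zero , p0 , λ _ ())
... | false with least? (p ∘ Fin.suc)
...   | inj₁ none              = inj₁ λ { Fin.zero → p0 ; (Fin.suc x) → none x }
...   | inj₂ (x , px , before) =
  inj₂ (Fin.suc x , px , λ { Fin.zero _ → p0 ; (Fin.suc y) (s≤s y<x) → before y y<x })

∖-nonempty : A ⊆ X → A ≢ X → ∃ λ x → inDiff A X x ≡ true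
∖-nonempty {A = A} {X} A⊆X A≢X with least? (inDiff A X)
... | inj₂ (x , x∈ , _) = x , x∈
... | inj₁ none         = contradiction (Subset.⊆-antisym A⊆X X⊆A) A≢X
  where
  X⊆A : X ⊆ A
  X⊆A {x} x∈X with lookup A x in x∈A
  ... | true  = lookup⇒∈ x∈A
  ... | false = contradiction (trans (sym (none x)) (∖-intro A X (∈⇒lookup x∈X) x∈A)) λ ()

<*⇒⊂ : A <* X → A ⊂ X
<*⇒⊂ {A = A} {X} (A⊆X , A≢X) = let x , x∈ = ∖-nonempty A⊆X A≢X ; x∈X , x∉A = ∖-elim A X x x∈ in
  A⊆X , x , lookup⇒∈ x∈X , λ x∈A → contradiction (trans (sym x∉A) (∈⇒lookup x∈A)) λ ()

leastInClass-intro : ∀ (D : Fin n → Bool) R x → (∀ y → D y ≡ true → R y x ≡ true → ¬ y Fin.< x) →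
  leastInClass D R x ≡ true
leastInClass-intro D R x least = cong (_≡ᵇ 0) (count≡0 not-earlier)
  where
  not-earlier : ∀ y → D y ∧ R y x ∧ (toℕ y <ᵇ toℕ x) ≡ false
  not-earlier y with D y in Dy | R y x in Ryx | toℕ y <ᵇ toℕ x in y<ᵇx
  ... | false | _     | _     = refl
  ... | true  | false | _     = refl
  ... | true  | true  | false = refl
  ... | true  | true  | true  =
    contradiction (ℕ.<ᵇ⇒< (toℕ y) (toℕ x) (from T-≡ y<ᵇx)) (least y Dy Ryx)

leastInClass-elim : ∀ (D : Fin n → Bool) R x → leastInClass D R x ≡ true →
  ∀ y → D y ≡ true → R y x ≡ true → ¬ y Fin.< x
leastInClass-elim D R x least y Dy Ryx y<x =
  contradiction (trans (sym (count≡0⁻¹ earlier none y)) counted) λ ()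
  where
  earlier : Fin _ → Bool
  earlier y = D y ∧ R y x ∧ (toℕ y <ᵇ toℕ x)
  none : count earlier ≡ 0
  none = ℕ.≡ᵇ⇒≡ (count earlier) 0 (from T-≡ least)
  counted : earlier y ≡ true
  counted rewrite Dy | Ryx = to T-≡ (ℕ.<⇒<ᵇ y<x)

vW-pos : ∀ (A X : Subset n) R x → inDiff A X x ≡ true → 0 < vW A X R
vW-pos A X R x x∈ with least? (inDiff A X)
... | inj₁ none                = contradiction (trans (sym (none x)) x∈) λ ()
... | inj₂ (m , m∈ , earliest) = count>0 (classRep A X R) m (∧-intro m∈
  (leastInClass-intro (inDiff A X) R m λ y y∈ _ y<m → contradiction (trans (sym (earliest y y<m)) y∈) λ ()))

-- The representative of a class of Y∖A goes to the least element of X∖A in that class.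
module _ {A X Y : Subset n} {R : BoolRel n} (equiv : IsEquivOn A Y R)
         (X⊆Y : ∀ x → inDiff A X x ≡ true → inDiff A Y x ≡ true)
         (covered : ∀ y → inDiff A Y y ≡ true → ∃ λ x → inDiff A X x ≡ true × R x y ≡ true) where

  private
    symmetric : ∀ x y → inDiff A Y x ≡ true → inDiff A Y y ≡ true → R x y ≡ true → R y x ≡ true
    symmetric = proj₁ (proj₂ equiv)

    transitive : ∀ x y z → inDiff A Y x ≡ true → inDiff A Y y ≡ true → inDiff A Y z ≡ true →
      R x y ≡ true → R y z ≡ true → R x z ≡ true
    transitive = proj₂ (proj₂ equiv)

    anchors : Fin n → Fin n → Bool
    anchors y x = inDiff A X x ∧ R x y

    anchor : Fin n → Fin n
    anchor y with least? (anchors y)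
    ... | inj₁ _       = y
    ... | inj₂ (x , _) = x

    anchor-least : ∀ y → inDiff A Y y ≡ true → Least (anchors y) (anchor y)
    anchor-least y y∈ with least? (anchors y)
    ... | inj₂ (_ , least) = least
    ... | inj₁ none        =
      let x , x∈ , Rxy = covered y y∈ in contradiction (trans (sym (none x)) (∧-intro x∈ Rxy)) λ ()

    anchor-rep : ∀ y → classRep A Y R y ≡ true → classRep A X R (anchor y) ≡ true
    anchor-rep y rep =
      let y∈ , _ = ∧-elim (inDiff A Y y) rep
          a∈ , Ray = ∧-elim (inDiff A X (anchor y)) (proj₁ (anchor-least y y∈))
      in ∧-intro a∈ (leastInClass-intro (inDiff A X) R (anchor y) λ z z∈ Rza z<a →
        contradiction (trans (sym (proj₂ (anchor-least y y∈) z z<a))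
                             (∧-intro z∈ (transitive z (anchor y) y (X⊆Y z z∈) (X⊆Y _ a∈) y∈ Rza Ray)))
                      λ ())

    anchor-injective : ∀ y y′ → classRep A Y R y ≡ true → classRep A Y R y′ ≡ true →
      anchor y ≡ anchor y′ → y ≡ y′
    anchor-injective y y′ rep rep′ same =
      let y∈ , least = ∧-elim (inDiff A Y y) rep
          y′∈ , least′ = ∧-elim (inDiff A Y y′) rep′
          a∈ , Ray = ∧-elim (inDiff A X (anchor y)) (proj₁ (anchor-least y y∈))
          _ , Ray′ = ∧-elim (inDiff A X (anchor y))
                       (subst (λ b → anchors y′ b ≡ true) (sym same) (proj₁ (anchor-least y′ y′∈)))
          Ryy′ : R y y′ ≡ true
          Ryy′ = transitive y (anchor y) y′ y∈ (X⊆Y _ a∈) y′∈ (symmetric (anchor y) y (X⊆Y _ a∈) y∈ Ray) Ray′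
      in Fin.≤-antisym
           (ℕ.≮⇒≥ (leastInClass-elim (inDiff A Y) R y least y′ y′∈ (symmetric y y′ y∈ y′∈ Ryy′)))
           (ℕ.≮⇒≥ (leastInClass-elim (inDiff A Y) R y′ least′ y y∈ Ryy′))

  vW-cover : vW A Y R ≤ vW A X R
  vW-cover = count-injection anchor anchor-rep anchor-injective

eW-mono : ∀ G {A X Y : Subset n} R → X ⊆ Y → eW G A X R ≤ eW G A Y R
eW-mono G {A} R X⊆Y = count2-mono λ x y → ∧-monoʳ (toℕ x <ᵇ toℕ y) (∧-monoʳ (adj G x y)
  (edgeIn-mono {a₁ = lookup A x} {lookup A y} {r = R x y} (⊆-lookup X⊆Y) (⊆-lookup X⊆Y)))
  where
  ∧-monoʳ : ∀ a {b c} → (b ≡ true → c ≡ true) → a ∧ b ≡ true → a ∧ c ≡ true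
  ∧-monoʳ true b⇒c = b⇒c

module ClosedExtension (A C : Subset n) (R : BoolRel n) (closed : ClosedNonempty A ⊤ R C) where

  A⊆A∪C : A ⊆ A ∪ C
  A⊆A∪C = Subset.p⊆p∪q C

  ∖-witness : ∃ λ x → inDiff A (A ∪ C) x ≡ true
  ∖-witness with (c , c∈C) ← proj₁ closed =
    c , ∖-intro A (A ∪ C) (trans (lookup-∪ A C c c∉A) (∈⇒lookup c∈C)) c∉A
    where
    c∉A : lookup A c ≡ false
    c∉A = proj₂ (∖-elim A ⊤ c (proj₁ (proj₂ closed) c c∈C))

  A≢A∪C : A ≢ A ∪ C
  A≢A∪C = ∖-nonempty⇒≢ (proj₁ ∖-witness) (proj₂ ∖-witness)

  unionOfClasses : IsEquivOn A ⊤ R → UnionOfClasses A (A ∪ C) ⊤ R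
  unionOfClasses (_ , symmetric , _) x y x∈ y∈ Rxy = begin
    lookup (A ∪ C) x ≡⟨ lookup-∪ A C x (proj₂ (∖-elim A ⊤ x x∈)) ⟩
    lookup C x       ≡⟨ same-side ⟩
    lookup C y       ≡⟨ lookup-∪ A C y (proj₂ (∖-elim A ⊤ y y∈)) ⟨
    lookup (A ∪ C) y ∎
    where
    open ≡-Reasoning
    closure : ∀ x y → x ∈ C → inDiff A ⊤ y ≡ true → R x y ≡ true → y ∈ C
    closure = proj₂ (proj₂ closed)
    same-side : lookup C x ≡ lookup C y
    same-side with lookup C x in Cx | lookup C y in Cy
    ... | true  | true  = refl
    ... | false | false = refl
    ... | true  | false = contradiction
      (trans (sym Cy) (∈⇒lookup (closure x y (lookup⇒∈ Cx) y∈ Rxy))) λ ()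
    ... | false | true  = contradiction
      (trans (sym Cx) (∈⇒lookup (closure y x (lookup⇒∈ Cy) x∈ (symmetric x y x∈ y∈ Rxy)))) λ ()

anyᵇ? : (p : Fin n → Bool) → Dec (∃ λ x → p x ≡ true)
anyᵇ? p = Fin.any? λ x → p x Bool.≟ true

module Saturation (A S : Subset n) (R : BoolRel n) (equiv : IsEquivOn A ⊤ R) where

  C : Subset n
  C = tabulate λ y → inDiff A ⊤ y ∧ ⌊ anyᵇ? (λ x → inDiff A S x ∧ R x y) ⌋

  private
    reflexive : ∀ x → inDiff A ⊤ x ≡ true → R x x ≡ true
    reflexive = proj₁ equiv

    transitive : ∀ x y z → inDiff A ⊤ x ≡ true → inDiff A ⊤ y ≡ true → inDiff A ⊤ z ≡ true →
      R x y ≡ true → R y z ≡ true → R x z ≡ true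
    transitive = proj₂ (proj₂ equiv)

    ∈C-intro : ∀ x y → inDiff A S x ≡ true → inDiff A ⊤ y ≡ true → R x y ≡ true → y ∈ C
    ∈C-intro x y x∈ y∈ Rxy = lookup⇒∈ (trans (Vec.lookup∘tabulate _ y) (∧-intro y∈
      (to T-≡ (fromWitness {a? = anyᵇ? (λ x → inDiff A S x ∧ R x y)} (x , ∧-intro x∈ Rxy)))))

    ∈C-elim : ∀ y → y ∈ C → inDiff A ⊤ y ≡ true × ∃ λ x → inDiff A S x ∧ R x y ≡ true
    ∈C-elim y y∈C =
      let y∈ , some = ∧-elim (inDiff A ⊤ y) (trans (sym (Vec.lookup∘tabulate _ y)) (∈⇒lookup y∈C))
      in y∈ , toWitness {a? = anyᵇ? (λ x → inDiff A S x ∧ R x y)} (from T-≡ some)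

    ∈C-intro-self : ∀ x → inDiff A S x ≡ true → x ∈ C
    ∈C-intro-self x x∈ = ∈C-intro x x x∈ (∖⊆⊤∖ A S x x∈) (reflexive x (∖⊆⊤∖ A S x x∈))

  covered : ∀ y → inDiff A (A ∪ C) y ≡ true → ∃ λ x → inDiff A S x ≡ true × R x y ≡ true
  covered y y∈ = let y∈A∪C , y∉A = ∖-elim A (A ∪ C) y y∈
                     x , xy = proj₂ (∈C-elim y (lookup⇒∈ (trans (sym (lookup-∪ A C y y∉A)) y∈A∪C)))
                 in x , ∧-elim (inDiff A S x) xy

  closedNonempty : ∀ x → inDiff A S x ≡ true → ClosedNonempty A ⊤ R C
  closedNonempty x x∈ = (x , ∈C-intro-self x x∈) , (λ y → proj₁ ∘ ∈C-elim y) , closure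
    where
    closure : ∀ y z → y ∈ C → inDiff A ⊤ z ≡ true → R y z ≡ true → z ∈ C
    closure y z y∈C z∈ Ryz with ∈C-elim y y∈C
    ... | y∈ , s , sy = let s∈ , Rsy = ∧-elim (inDiff A S s) sy in
      ∈C-intro s z s∈ z∈ (transitive s y z (∖⊆⊤∖ A S s s∈) y∈ z∈ Rsy Ryz)

  S⊆A∪C : S ⊆ A ∪ C
  S⊆A∪C {x} x∈S with lookup A x in x∈A
  ... | true  = Subset.p⊆p∪q C (lookup⇒∈ x∈A)
  ... | false = Subset.q⊆p∪q A C (∈C-intro-self x (∖-intro A S (∈⇒lookup x∈S) x∈A))

  S∖A⊆A∪C∖A : ∀ x → inDiff A S x ≡ true → inDiff A (A ∪ C) x ≡ true
  S∖A⊆A∪C∖A = ∖-monoʳ A S⊆A∪C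

-- Rational approximation of α

<⇔ℕ : ∀ {x y : ℚ} {m i k j} → toℚᵘ x ≃ mkℚᵘ (+ m) i → toℚᵘ y ≃ mkℚᵘ (+ k) j →
  x ℚ.< y ⇔ m * suc j < k * suc i
<⇔ℕ {m = m} {i} {k} {j} x≃ y≃ = mk⇔
  (λ x<y → unwrap (ℚᵘ.<-respʳ-≃ y≃ (ℚᵘ.<-respˡ-≃ x≃ (ℚ.toℚᵘ-mono-< x<y))))
  (λ lt → ℚ.toℚᵘ-cancel-< (ℚᵘ.<-respʳ-≃ (ℚᵘ.≃-sym y≃) (ℚᵘ.<-respˡ-≃ (ℚᵘ.≃-sym x≃) (wrap lt))))
  where
  unwrap : mkℚᵘ (+ m) i ℚᵘ.< mkℚᵘ (+ k) j → m * suc j < k * suc i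
  unwrap (*<* lt) = ℤ.drop‿+<+ (subst₂ ℤ._<_ (sym (ℤ.pos-* m (suc j))) (sym (ℤ.pos-* k (suc i))) lt)
  wrap : m * suc j < k * suc i → mkℚᵘ (+ m) i ℚᵘ.< mkℚᵘ (+ k) j
  wrap lt = *<* (subst₂ ℤ._<_ (ℤ.pos-* m (suc j)) (ℤ.pos-* k (suc i)) (+<+ lt))

fraction : ℕ → ℕ → ℚ
fraction v e = (+ v) ℚ./ suc e

ℕtoℚ≃ : ∀ v → toℚᵘ (ℕtoℚ v) ≃ mkℚᵘ (+ v) 0
ℕtoℚ≃ v = ℚ.toℚᵘ-fromℚᵘ (mkℚᵘ (+ v) 0)

fraction≃ : ∀ v e → toℚᵘ (fraction v e) ≃ mkℚᵘ (+ v) e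
fraction≃ v e = ℚ.toℚᵘ-fromℚᵘ (mkℚᵘ (+ v) e)

scaled≃ : ∀ a d′ .(c : Coprime a (suc d′)) e → toℚᵘ (mkℚ (+ a) d′ c ℚ.* ℕtoℚ e) ≃ mkℚᵘ (+ (a * e)) d′
scaled≃ a d′ c e = ℚᵘ.≃-trans (ℚ.toℚᵘ-homo-* (mkℚ (+ a) d′ c) (ℕtoℚ e))
  (ℚᵘ.≃-trans (ℚᵘ.*-congˡ {mkℚᵘ (+ a) d′} (ℕtoℚ≃ e)) (ℚᵘ.*≡* eq))
  where
  eq : (+ a ℤ.* + e) ℤ.* + suc d′ ≡ + (a * e) ℤ.* + suc (d′ * 1)
  eq = cong₂ (λ m k → m ℤ.* + suc k) (sym (ℤ.pos-* a e)) (sym (ℕ.*-identityʳ d′))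

fraction-scaled : ∀ v e → fraction v e ℚ.* ℕtoℚ (suc e) ≡ ℕtoℚ v
fraction-scaled v e = ℚ.toℚᵘ-injective (ℚᵘ.≃-trans (ℚ.toℚᵘ-homo-* (fraction v e) (ℕtoℚ (suc e)))
  (ℚᵘ.≃-trans (ℚᵘ.*-cong (fraction≃ v e) (ℕtoℚ≃ (suc e)))
  (ℚᵘ.≃-trans (ℚᵘ.*≡* eq) (ℚᵘ.≃-sym (ℕtoℚ≃ v)))))
  where
  eq : (+ v ℤ.* + suc e) ℤ.* + 1 ≡ + v ℤ.* + (suc e * 1)
  eq = trans (ℤ.*-identityʳ _) (cong (λ k → + v ℤ.* + k) (sym (ℕ.*-identityʳ (suc e))))

module _ (a d′ : ℕ) .(c : Coprime a (suc d′)) where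

  private
    q₀ : ℚ
    q₀ = mkℚ (+ a) d′ c

    d : ℕ
    d = suc d′

  scaled<⇔ : ∀ e v → q₀ ℚ.* ℕtoℚ e ℚ.< ℕtoℚ v ⇔ a * e < d * v
  scaled<⇔ e v = subst₂ (λ m k → (q₀ ℚ.* ℕtoℚ e ℚ.< ℕtoℚ v) ⇔ m < k)
    (ℕ.*-identityʳ (a * e)) (ℕ.*-comm v d) (<⇔ℕ (scaled≃ a d′ c e) (ℕtoℚ≃ v))

  scaled>⇔ : ∀ e v → ℕtoℚ v ℚ.< q₀ ℚ.* ℕtoℚ e ⇔ d * v < a * e
  scaled>⇔ e v = subst₂ (λ m k → (ℕtoℚ v ℚ.< q₀ ℚ.* ℕtoℚ e) ⇔ m < k)
    (ℕ.*-comm v d) (ℕ.*-identityʳ (a * e)) (<⇔ℕ (ℕtoℚ≃ v) (scaled≃ a d′ c e))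

  fraction<⇔ : ∀ v e → fraction v e ℚ.< q₀ ⇔ v * d < a * suc e
  fraction<⇔ v e = <⇔ℕ (fraction≃ v e) ℚᵘ.≃-refl

  fraction>⇔ : ∀ v e → q₀ ℚ.< fraction v e ⇔ a * suc e < v * d
  fraction>⇔ v e = <⇔ℕ ℚᵘ.≃-refl (fraction≃ v e)

-- Instance search cannot see through the gcd normalisation in ℕtoℚ v = (+ v) / 1, so the
-- sign instances needed by ℚ.Properties are supplied via the normal form ℕᵠ v.
private
  ℕᵠ : ℕ → ℚ
  ℕᵠ v = mkℚ (+ v) 0 (Coprime.sym (1-coprimeTo v))

  ℕtoℚ≡ℕᵠ : ∀ v → ℕtoℚ v ≡ ℕᵠ v
  ℕtoℚ≡ℕᵠ v = ℚ.↥p/↧p≡p (ℕᵠ v)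

*-monoˡ-<-ℕtoℚ : ∀ {p q} e → p ℚ.< q → p ℚ.* ℕtoℚ (suc e) ℚ.< q ℚ.* ℕtoℚ (suc e)
*-monoˡ-<-ℕtoℚ e rewrite ℕtoℚ≡ℕᵠ (suc e) = ℚ.*-monoˡ-<-pos (ℕᵠ (suc e))

*-monoˡ-≤-ℕtoℚ : ∀ {p q} e → p ℚ.≤ q → p ℚ.* ℕtoℚ e ℚ.≤ q ℚ.* ℕtoℚ e
*-monoˡ-≤-ℕtoℚ e rewrite ℕtoℚ≡ℕᵠ e = ℚ.*-monoʳ-≤-nonNeg (ℕᵠ e)

*-cancelʳ-<-ℕtoℚ : ∀ {p q} e → p ℚ.* ℕtoℚ e ℚ.< q ℚ.* ℕtoℚ e → p ℚ.< q
*-cancelʳ-<-ℕtoℚ e rewrite ℕtoℚ≡ℕᵠ e = ℚ.*-cancelʳ-<-nonNeg (ℕᵠ e)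

0≤ℕtoℚ : ∀ v → 0ℚ ℚ.≤ ℕtoℚ v
0≤ℕtoℚ v rewrite ℕtoℚ≡ℕᵠ v = ℚ.nonNegative⁻¹ (ℕᵠ v)

module _ (α : IrrationalCut) where

  below<above : ∀ {p q} → below α p ≡ true → below α q ≡ false → p ℚ.< q
  below<above {p} {q} bp bq = ℚ.≰⇒> λ q≤p → contradiction (trans (sym bq) (downward α q p q≤p bp)) λ ()

  Ceiling : List ℚ → ℚ → Set
  Ceiling rs q = below α q ≡ true × 0ℚ ℚ.≤ q × All (λ r → below α r ≡ true → r ℚ.< q) rs

  ceiling : ∀ rs → ∃ (Ceiling rs)
  ceiling []       = 0ℚ , zero-below α , ℚ.≤-refl , []
  ceiling (r ∷ rs) with ceiling rs | below α r in br
  ... | q , bq , 0≤q , under | false =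
    q , bq , 0≤q , (λ b → contradiction (trans (sym br) b) λ ()) ∷ under
  ... | q , bq , 0≤q , under | true with r ℚ.<? q
  ...   | yes r<q = q , bq , 0≤q , (λ _ → r<q) ∷ under
  ...   | no  r≮q with noMax α r br
  ...     | s , r<s , bs = s , bs , ℚ.≤-trans 0≤q (ℚ.<⇒≤ q<s) ,
                           (λ _ → r<s) ∷ All.map (λ r′<q b → ℚ.<-trans (r′<q b) q<s) under
    where
    q<s : q ℚ.< s
    q<s = ℚ.≤-<-trans (ℚ.≮⇒≥ r≮q) r<s

grid : ℕ → List ℚ
grid K = cartesianProductWith fraction (upTo (suc K)) (upTo K)

∈-grid : ∀ {K v e} → v ≤ K → e < K → fraction v e ∈ˡ grid K
∈-grid v≤K e<K = ∈-cartesianProductWith⁺ fraction (∈-upTo⁺ (s≤s v≤K)) (∈-upTo⁺ e<K)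

record Approximation (α : IrrationalCut) (K : ℕ) : Set where
  field
    num den : ℕ
    pos⇔   : ∀ {v e} → v ≤ K → e ≤ K → WPos α v e ⇔ num * e < den * v
    neg⇔   : ∀ {v e} → v ≤ K → e ≤ K → WNeg α v e ⇔ den * v < num * e
    no-tie : ∀ {v e} → 0 < v → v ≤ K → e ≤ K → num * e ≢ den * v

module _ (α : IrrationalCut) (K a d′ : ℕ) .(c : Coprime a (suc d′))
         (ceil : Ceiling α (grid K) (mkℚ (+ a) d′ c)) where

  private
    q₀ : ℚ
    q₀ = mkℚ (+ a) d′ c

    d : ℕ
    d = suc d′

    q₀-below : below α q₀ ≡ true
    q₀-below = proj₁ ceil

    separated : ∀ {v e} → v ≤ K → e < K → below α (fraction v e) ≡ true → fraction v e ℚ.< q₀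
    separated v≤K e<K = All.lookup (proj₂ (proj₂ ceil)) (∈-grid v≤K e<K)

    pos⇒ : ∀ {v e} → WPos α v e → a * e < d * v
    pos⇒ {v} {e} (q , q-above , qe<v) = to (scaled<⇔ a d′ c e v)
      (ℚ.≤-<-trans (*-monoˡ-≤-ℕtoℚ e (ℚ.<⇒≤ (below<above α q₀-below q-above))) qe<v)

    pos⇐ : ∀ {v e} → v ≤ K → e ≤ K → a * e < d * v → WPos α v e
    pos⇐ {v} {zero} _ _ ae<dv = 1ℚ , one-above α , from (scaled<⇔ 1 0 (1-coprimeTo 1) 0 v)
      (ℕ.<-≤-trans (ℕ.n≢0⇒n>0 λ { refl → contradiction (subst₂ _<_ (ℕ.*-zeroʳ a) (ℕ.*-zeroʳ d) ae<dv) λ () })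
                   (ℕ.≤-reflexive (sym (ℕ.+-identityʳ v))))
    pos⇐ {v} {suc e} v≤K e<K ae<dv with below α (fraction v e) in f-below
    ... | true  = contradiction (to (fraction<⇔ a d′ c v e) (separated v≤K e<K f-below))
                                (ℕ.<⇒≯ (subst (a * suc e <_) (ℕ.*-comm d v) ae<dv))
    ... | false with noMin α (fraction v e) f-below
    ...   | q , q<f , q-above = q , q-above ,
      subst (q ℚ.* ℕtoℚ (suc e) ℚ.<_) (fraction-scaled v e) (*-monoˡ-<-ℕtoℚ e q<f)

    neg⇒ : ∀ {v e} → v ≤ K → e ≤ K → WNeg α v e → d * v < a * e
    neg⇒ {v} {zero} _ _ (q , _ , v<0) =
      contradiction (ℚ.≤-<-trans (0≤ℕtoℚ v) (subst (ℕtoℚ v ℚ.<_) (ℚ.*-zeroʳ q) v<0)) (ℚ.<-irrefl refl)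
    neg⇒ {v} {suc e} v≤K e<K (q , q-below , v<qe) = subst (_< a * suc e) (ℕ.*-comm v d)
      (to (fraction<⇔ a d′ c v e) (separated v≤K e<K (downward α _ q (ℚ.<⇒≤ f<q) q-below)))
      where
      f<q : fraction v e ℚ.< q
      f<q = *-cancelʳ-<-ℕtoℚ (suc e) (subst (ℚ._< q ℚ.* ℕtoℚ (suc e)) (sym (fraction-scaled v e)) v<qe)

    neg⇐ : ∀ {v e} → d * v < a * e → WNeg α v e
    neg⇐ {v} {e} dv<ae = q₀ , q₀-below , from (scaled>⇔ a d′ c e v) dv<ae

    no-tie : ∀ {v e} → 0 < v → v ≤ K → e ≤ K → a * e ≢ d * v
    no-tie {v} {zero} 0<v _ _ eq =
      ℕ.<-irrefl (trans (sym (ℕ.*-zeroʳ a)) eq) (ℕ.<-≤-trans 0<v (ℕ.m≤m+n v (d′ * v)))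
    no-tie {v} {suc e} 0<v v≤K e<K eq with below α (fraction v e) in f-below
    ... | true  = ℕ.<-irrefl (trans (ℕ.*-comm v d) (sym eq))
                             (to (fraction<⇔ a d′ c v e) (separated v≤K e<K f-below))
    ... | false = ℕ.<-irrefl (trans eq (ℕ.*-comm d v))
                             (to (fraction>⇔ a d′ c v e) (below<above α q₀-below f-below))

  approximation-from-ceiling : Approximation α K
  approximation-from-ceiling = record
    { num    = a
    ; den    = d
    ; pos⇔   = λ v≤K e≤K → mk⇔ pos⇒ (pos⇐ v≤K e≤K)
    ; neg⇔   = λ v≤K e≤K → mk⇔ (neg⇒ v≤K e≤K) neg⇐
    ; no-tie = no-tie
    }

approximation : ∀ α K → Approximation α K
approximation α K with ceiling α (grid K)
... | mkℚ (+ a)    d′ c , ceil          = approximation-from-ceiling α K a d′ c ceil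
... | mkℚ -[1+ _ ] _  _ , _ , 0≤q , _ = ⊥-elim (ℤ.NonNegative.nonNeg (ℚ.nonNegative 0≤q))

descent : ∀ {X : Set} {P : X → Set} (μ : X → ℕ) →
  (∀ x → P x → ¬ ¬ ∃ λ y → P y × μ y < μ x) → ∀ x → ¬ P x
descent {P = P} μ smaller = WF.All.wfRec (On.wellFounded μ <-wellFounded) _ (λ x → ¬ P x)
  λ x rec Px → smaller x Px λ (y , Py , y<x) → rec y<x Py

¬¬-by-cases : {A B : Set} → (A → ¬ ¬ B) → (¬ A → ¬ ¬ B) → ¬ ¬ B
¬¬-by-cases if-yes if-no ¬b = if-no (λ a → if-yes a ¬b) ¬b

¬∀⇒¬¬∃¬ : {X : Set} {Q S : X → Set} → (∀ x → Stable (S x)) →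
  ¬ (∀ x → Q x → S x) → ¬ ¬ ∃ λ x → Q x × ¬ S x
¬∀⇒¬¬∃¬ stable ¬∀ none = ¬∀ λ x q → stable x λ ¬s → none (x , q , ¬s)

module Score (a d : ℕ) where

  Pos Neg : ℕ → ℕ → Set
  Pos v e = a * e < d * v
  Neg v e = d * v < a * e

  Better : ℕ → ℕ → ℕ → ℕ → Set
  Better v′ e′ v e = a * e′ + d * v < a * e + d * v′

  Pos-+ : ∀ {v₀ e₀ v₁ e₁} → Pos v₀ e₀ → Pos v₁ e₁ → Pos (v₀ + v₁) (e₀ + e₁)
  Pos-+ {v₀} {e₀} {v₁} {e₁} pos₀ pos₁ =
    subst₂ _<_ (sym (ℕ.*-distribˡ-+ a e₀ e₁)) (sym (ℕ.*-distribˡ-+ d v₀ v₁)) (ℕ.+-mono-< pos₀ pos₁)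

  Better-+ : ∀ {v₀ e₀ v₁ e₁} v₂ e₂ → Pos v₀ e₀ → Neg v₁ e₁ →
    Better (v₀ + v₂) (e₀ + e₂) (v₁ + v₂) (e₁ + e₂)
  Better-+ {v₀} {e₀} {v₁} {e₁} v₂ e₂ pos₀ neg₁ = begin-strict
    a * (e₀ + e₂) + d * (v₁ + v₂)          ≡⟨ regroup e₀ v₁ ⟩
    (a * e₀ + d * v₁) + (a * e₂ + d * v₂)  <⟨ ℕ.+-monoˡ-< _ (ℕ.+-mono-< pos₀ neg₁) ⟩
    (d * v₀ + a * e₁) + (a * e₂ + d * v₂)  ≡⟨ cong (_+ (a * e₂ + d * v₂)) (ℕ.+-comm (d * v₀) (a * e₁)) ⟩
    (a * e₁ + d * v₀) + (a * e₂ + d * v₂)  ≡⟨ regroup e₁ v₀ ⟨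
    a * (e₁ + e₂) + d * (v₀ + v₂)          ∎
    where
    open ℕ.≤-Reasoning
    regroup : ∀ e v → a * (e + e₂) + d * (v + v₂) ≡ (a * e + d * v) + (a * e₂ + d * v₂)
    regroup e v = trans (cong₂ _+_ (ℕ.*-distribˡ-+ a e e₂) (ℕ.*-distribˡ-+ d v v₂))
                        (interchange (a * e) (a * e₂) (d * v) (d * v₂))

  Better-Pos : ∀ {v′ e′ v e} → Better v′ e′ v e → Pos v e → Pos v′ e′
  Better-Pos {v′} {e′} {v} {e} better pos = ℕ.+-cancelʳ-< (d * v) _ _ (begin-strict
    a * e′ + d * v <⟨ better ⟩
    a * e + d * v′ <⟨ ℕ.+-monoˡ-< (d * v′) pos ⟩
    d * v + d * v′ ≡⟨ ℕ.+-comm (d * v) (d * v′) ⟩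
    d * v′ + d * v ∎)
    where open ℕ.≤-Reasoning

  -- The weight d·v − a·e, negated and shifted into ℕ (for v ≤ N).
  deficit : ℕ → ℕ → ℕ → ℕ
  deficit N v e = d * (N ∸ v) + a * e

  Better-deficit : ∀ {N v′ e′ v e} → v′ ≤ N → v ≤ N → Better v′ e′ v e →
    deficit N v′ e′ < deficit N v e
  Better-deficit {N} {v′} {e′} {v} {e} v′≤N v≤N better = ℕ.+-cancelʳ-< (d * v′ + d * v) _ _ (begin-strict
    d * (N ∸ v′) + a * e′ + (d * v′ + d * v)  ≡⟨ interchange (d * (N ∸ v′)) (a * e′) (d * v′) (d * v) ⟩
    (d * (N ∸ v′) + d * v′) + (a * e′ + d * v) ≡⟨ cong (_+ (a * e′ + d * v)) (restore v′≤N) ⟩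
    d * N + (a * e′ + d * v)                   <⟨ ℕ.+-monoʳ-< (d * N) better ⟩
    d * N + (a * e + d * v′)                   ≡⟨ cong (_+ (a * e + d * v′)) (restore v≤N) ⟨
    (d * (N ∸ v) + d * v) + (a * e + d * v′)   ≡⟨ interchange (d * (N ∸ v)) (d * v) (a * e) (d * v′) ⟩
    d * (N ∸ v) + a * e + (d * v + d * v′)     ≡⟨ cong (λ s → d * (N ∸ v) + a * e + s) (ℕ.+-comm (d * v) (d * v′)) ⟩
    d * (N ∸ v) + a * e + (d * v′ + d * v)     ∎)
    where
    open ℕ.≤-Reasoning
    restore : ∀ {u} → u ≤ N → d * (N ∸ u) + d * u ≡ d * N
    restore {u} u≤N = trans (sym (ℕ.*-distribˡ-+ d (N ∸ u) u)) (cong (d *_) (ℕ.m∸n+n≡m u≤N))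

-- Signs of weights, and the two directions

module _ (α : IrrationalCut) {n : ℕ} (G : Graph n) where

  private
    K : ℕ
    K = n + n * n
    open Approximation (approximation α K) renaming (num to a; den to d)
    open Score a d

  v≤K : ∀ A X R → vW A X R ≤ K
  v≤K A X R = ℕ.≤-trans (count≤n (classRep A X R)) (ℕ.m≤m+n n (n * n))

  e≤K : ∀ A X R → eW G A X R ≤ K
  e≤K A X R = ℕ.≤-trans (count2≤n*m {n} {n} _) (ℕ.m≤n+m (n * n) n)

  module _ (A X : Subset n) (R : BoolRel n) where

    wPos⇔ : wPos α G A X R ⇔ Pos (vW A X R) (eW G A X R)
    wPos⇔ = pos⇔ (v≤K A X R) (e≤K A X R)

    wNeg⇔ : wNeg α G A X R ⇔ Neg (vW A X R) (eW G A X R)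
    wNeg⇔ = neg⇔ (v≤K A X R) (e≤K A X R)

    wPos? : Dec (wPos α G A X R)
    wPos? = map′ (from wPos⇔) (to wPos⇔) (_ ℕ.<? _)

    wNeg? : Dec (wNeg α G A X R)
    wNeg? = map′ (from wNeg⇔) (to wNeg⇔) (_ ℕ.<? _)

    wPos⇒¬wNeg : wPos α G A X R → ¬ wNeg α G A X R
    wPos⇒¬wNeg pos neg = ℕ.<-asym (to wPos⇔ pos) (to wNeg⇔ neg)

    module _ {x : Fin n} (x∈ : inDiff A X x ≡ true) where

      private
        tie-free : a * eW G A X R ≢ d * vW A X R
        tie-free = no-tie (vW-pos A X R x x∈) (v≤K A X R) (e≤K A X R)

      ¬wNeg⇒wPos : ¬ wNeg α G A X R → wPos α G A X R
      ¬wNeg⇒wPos ¬neg = from wPos⇔ (ℕ.≤∧≢⇒< (ℕ.≮⇒≥ (¬neg ∘ from wNeg⇔)) tie-free)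

      ¬wPos⇒wNeg : ¬ wPos α G A X R → wNeg α G A X R
      ¬wPos⇒wNeg ¬pos = from wNeg⇔ (ℕ.≤∧≢⇒< (ℕ.≮⇒≥ (¬pos ∘ from wPos⇔)) (tie-free ∘ sym))

  <c-stable : ∀ {A Y} → Stable ((α , G) ⊢ A <c Y)
  <c-stable {A} {Y} ¬¬A<cY =
    ( decidable-stable (A Subset.⊆? Y) (¬¬-map (proj₁ ∘ proj₁) ¬¬A<cY)
    , negated-stable (¬¬-map (proj₂ ∘ proj₁) ¬¬A<cY) )
    , λ R t → decidable-stable (wNeg? A Y R) (¬¬-map (λ A<cY → proj₂ A<cY R t) ¬¬A<cY)

  ¬<c⇒wPos : ∀ {A Y} → A ⊆ Y → A ≢ Y → ¬ ((α , G) ⊢ A <c Y) →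
    ¬ ¬ ∃ λ R → InT A Y R × wPos α G A Y R
  ¬<c⇒wPos {A} {Y} A⊆Y A≢Y ¬A<cY = do
    R , t , ¬neg ← ¬∀⇒¬¬∃¬ (λ R → decidable-stable (wNeg? A Y R)) (¬A<cY ∘ ((A⊆Y , A≢Y) ,_))
    pure (R , t , ¬wNeg⇒wPos A Y R (proj₂ (∖-nonempty A⊆Y A≢Y)) ¬neg)

  glue-wPos : ∀ {A M Y R₀ R₁} → InT A M R₀ → wPos α G A M R₀ → InT M Y R₁ → wPos α G M Y R₁ →
    InT A Y (glue M R₀ R₁) × wPos α G A Y (glue M R₀ R₁)
  glue-wPos {A} {M} {Y} {R₀} {R₁} (A⊆M , equiv₀) pos₀ (M⊆Y , equiv₁) pos₁ =
    (Subset.⊆-trans A⊆M M⊆Y , glue-isEquiv {A = A} {M} {Y} equiv₀ equiv₁) ,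
    from (wPos⇔ A Y _) (subst₂ Pos (sym (vW-glue A⊆M M⊆Y)) (sym (eW-glue A⊆M M⊆Y G))
                                   (Pos-+ (to (wPos⇔ A M R₀) pos₀) (to (wPos⇔ M Y R₁) pos₁)))

  Ξ⇒≤s : ∀ {A R} → InXi α G A ⊤ R → (α , G) ⊢ A ≤s ⊤
  Ξ⇒≤s {A} {R} ((_ , equiv) , ξ) = Subset.⊆⊤ , no-intrinsic
    where
    no-intrinsic : ¬ Σ (Subset n) λ A′ → ((α , G) ⊢ A <i A′) × (A′ ⊆ ⊤)
    no-intrinsic (A′ , ((A⊆A′ , intrinsic) , A≢A′) , _) = ℕ.<-irrefl refl (begin-strict
      a * eW G A A′ R       ≤⟨ ℕ.*-monoʳ-≤ a (eW-mono G {A} R S⊆A∪C) ⟩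
      a * eW G A (A ∪ C) R  <⟨ to (wPos⇔ A (A ∪ C) R) (ξ C (closedNonempty _ (proj₂ (∖-nonempty A⊆A′ A≢A′)))) ⟩
      d * vW A (A ∪ C) R    ≤⟨ ℕ.*-monoʳ-≤ d (vW-cover {A = A} {A′} {A ∪ C} equiv∪ S∖A⊆A∪C∖A covered) ⟩
      d * vW A A′ R         <⟨ to (wNeg⇔ A A′ R) (proj₂ A<cA′ R (A⊆A′ , equiv′)) ⟩
      a * eW G A A′ R       ∎)
      where
      open ℕ.≤-Reasoning
      open Saturation A A′ R equiv
      A<cA′ : (α , G) ⊢ A <c A′
      A<cA′ = intrinsic A Subset.⊆-refl (A⊆A′ , A≢A′)
      equiv′ : IsEquivOn A A′ R
      equiv′ = IsEquivOn-restrict {A = A} {⊤} {A} {A′} (∖⊆⊤∖ A A′) equiv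
      equiv∪ : IsEquivOn A (A ∪ C) R
      equiv∪ = IsEquivOn-restrict {A = A} {⊤} {A} {A ∪ C} (∖⊆⊤∖ A (A ∪ C)) equiv

  ≤s⇒¬<c : ∀ {A} → (α , G) ⊢ A ≤s ⊤ → ∀ Y → ¬ ((α , G) ⊢ A <c Y)
  ≤s⇒¬<c {A} (_ , no-intrinsic) = descent ∣_∣ shrink
    where
    shrink : ∀ Y → (α , G) ⊢ A <c Y → ¬ ¬ ∃ λ Y′ → ((α , G) ⊢ A <c Y′) × ∣ Y′ ∣ < ∣ Y ∣
    shrink Y ((A⊆Y , A≢Y) , negative) = do
      A′ , A⊆A′ , A′<*Y , ¬A′<cY ← not-intrinsic
      R₁ , t₁ , pos₁ ← ¬<c⇒wPos (proj₁ A′<*Y) (proj₂ A′<*Y) ¬A′<cY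
      ¬¬-by-cases (λ A≡A′ → contradiction (subst (λ Z → InT Z Y R₁ × wPos α G Z Y R₁) (sym A≡A′) (t₁ , pos₁))
                                          not-positive) λ A≢A′ →
        ¬¬-by-cases (λ A<cA′ → pure (A′ , A<cA′ , Subset.p⊂q⇒∣p∣<∣q∣ (<*⇒⊂ A′<*Y))) λ ¬A<cA′ → do
          R₀ , t₀ , pos₀ ← ¬<c⇒wPos A⊆A′ A≢A′ ¬A<cA′
          contradiction (glue-wPos t₀ pos₀ t₁ pos₁) not-positive
      where
      not-positive : ∀ {R} → ¬ (InT A Y R × wPos α G A Y R)
      not-positive {R} (t , pos) = wPos⇒¬wNeg A Y R pos (negative R t)
      not-intrinsic : ¬ ¬ ∃ λ A′ → A ⊆ A′ × A′ <* Y × ¬ ((α , G) ⊢ A′ <c Y)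
      not-intrinsic none = no-intrinsic (Y , ((A⊆Y , λ A′ A⊆A′ A′<*Y →
        <c-stable λ ¬A′<cY → none (A′ , A⊆A′ , A′<*Y , ¬A′<cY)) , A≢Y) , Subset.⊆⊤)

  ≤s⇒¬¬Ξ : ∀ {A} → (α , G) ⊢ A ≤s ⊤ → A ≢ ⊤ →
    ¬ ¬ ∃ λ R → InT A ⊤ R × wPos α G A ⊤ R × InXi α G A ⊤ R
  ≤s⇒¬¬Ξ {A} A≤s⊤ A≢⊤ noΞ =
    ¬<c⇒wPos Subset.⊆⊤ A≢⊤ (≤s⇒¬<c A≤s⊤ ⊤) λ (R , candidate) → descent μ improve R candidate
    where
    Candidate : BoolRel n → Set
    Candidate R = InT A ⊤ R × wPos α G A ⊤ R

    μ : BoolRel n → ℕ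
    μ R = deficit n (vW A ⊤ R) (eW G A ⊤ R)

    improve : ∀ R → Candidate R → ¬ ¬ ∃ λ R′ → Candidate R′ × μ R′ < μ R
    improve R (t@(_ , equiv) , pos) = do
      C , closed , ¬posC ← ¬∀⇒¬¬∃¬ (λ C → decidable-stable (wPos? A (A ∪ C) R))
                                   (λ ξ → noΞ (R , t , pos , t , ξ))
      let open ClosedExtension A C R closed
          neg : Neg (vW A (A ∪ C) R) (eW G A (A ∪ C) R)
          neg = to (wNeg⇔ A (A ∪ C) R) (¬wPos⇒wNeg A (A ∪ C) R (proj₂ ∖-witness) ¬posC)
          union : UnionOfClasses A (A ∪ C) ⊤ R
          union = unionOfClasses equiv
      R₀ , (_ , equiv₀) , pos₀ ← ¬<c⇒wPos A⊆A∪C A≢A∪C (≤s⇒¬<c A≤s⊤ (A ∪ C))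
      let R′ : BoolRel n
          R′ = glue (A ∪ C) R₀ R
          better : Better (vW A ⊤ R′) (eW G A ⊤ R′) (vW A ⊤ R) (eW G A ⊤ R)
          better = subst₂ (λ v e → Better (vW A ⊤ R′) (eW G A ⊤ R′) v e)
                     (sym (vW-split A⊆A∪C Subset.⊆⊤ union)) (sym (eW-split A⊆A∪C Subset.⊆⊤ union G))
                     (subst₂ (λ v e → Better v e _ _)
                       (sym (vW-glue A⊆A∪C Subset.⊆⊤)) (sym (eW-glue A⊆A∪C Subset.⊆⊤ G))
                       (Better-+ (vW (A ∪ C) ⊤ R) (eW G (A ∪ C) ⊤ R) (to (wPos⇔ A (A ∪ C) R₀) pos₀) neg))
          equiv′ : IsEquivOn A ⊤ R′
          equiv′ = glue-isEquiv {A = A} {A ∪ C} {⊤} equiv₀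
                     (IsEquivOn-restrict {A = A} {⊤} {A ∪ C} {⊤} (∖-antitoneˡ ⊤ A⊆A∪C) equiv)
          candidate : Candidate R′
          candidate = (Subset.⊆⊤ , equiv′) , from (wPos⇔ A ⊤ R′) (Better-Pos better (to (wPos⇔ A ⊤ R) pos))
      pure (R′ , candidate , Better-deficit (count≤n (classRep A ⊤ R′)) (count≤n (classRep A ⊤ R)) better)

-- Searching for a witness

Searchable : Set → Set₁
Searchable X = ∀ {P : X → Set} → Decidable P → Dec (∃ P)

searchVec : ∀ {X} → Searchable X → ∀ k → Searchable (Vec X k)
searchVec search zero    P? = map′ ([] ,_) (λ { ([] , p) → p }) (P? [])
searchVec search (suc k) P? = map′ (λ (x , xs , p) → x ∷ xs , p) (λ { (x ∷ xs , p) → x , xs , p })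
  (search λ x → searchVec search k λ xs → P? (x ∷ xs))

all? : ∀ {X} → Searchable X → ∀ {P : X → Set} → Decidable P → Dec (∀ x → P x)
all? search P? with search (¬? ∘ P?)
... | yes (x , ¬px) = no λ all → ¬px (all x)
... | no  none      = yes λ x → decidable-stable (P? x) λ ¬px → none (x , ¬px)

rows→rel : Vec (Subset n) n → BoolRel n
rows→rel rows x y = lookup (lookup rows x) y

rel→rows : BoolRel n → Vec (Subset n) n
rel→rows R = tabulate λ x → tabulate (R x)

rows→rel∘rel→rows : ∀ (R : BoolRel n) x y → rows→rel (rel→rows R) x y ≡ R x y
rows→rel∘rel→rows R x y =
  trans (cong (λ row → lookup row y) (Vec.lookup∘tabulate _ x)) (Vec.lookup∘tabulate (R x) y)

module _ (α : IrrationalCut) {n : ℕ} (G : Graph n) where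

  Ξ-witness : Subset n → BoolRel n → Set
  Ξ-witness A R = InT A ⊤ R × wPos α G A ⊤ R × InXi α G A ⊤ R

  private
    true? : ∀ b → Dec (b ≡ true)
    true? b = b Bool.≟ true

    IsEquivOn? : ∀ (A X : Subset n) R → Dec (IsEquivOn A X R)
    IsEquivOn? A X R =
      Fin.all? (λ x → true? (inDiff A X x) →-dec true? (R x x)) ×-dec
      Fin.all? (λ x → Fin.all? λ y → true? (inDiff A X x) →-dec true? (inDiff A X y) →-dec
                                      true? (R x y) →-dec true? (R y x)) ×-dec
      Fin.all? (λ x → Fin.all? λ y → Fin.all? λ z →
        true? (inDiff A X x) →-dec true? (inDiff A X y) →-dec true? (inDiff A X z) →-dec
        true? (R x y) →-dec true? (R y z) →-dec true? (R x z))

    ClosedNonempty? : ∀ (A : Subset n) R C → Dec (ClosedNonempty A ⊤ R C)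
    ClosedNonempty? A R C =
      Subset.nonempty? C ×-dec
      Fin.all? (λ x → x Subset.∈? C →-dec true? (inDiff A ⊤ x)) ×-dec
      Fin.all? (λ x → Fin.all? λ y →
        x Subset.∈? C →-dec true? (inDiff A ⊤ y) →-dec true? (R x y) →-dec y Subset.∈? C)

    InT? : ∀ (A : Subset n) R → Dec (InT A ⊤ R)
    InT? A R = yes Subset.⊆⊤ ×-dec IsEquivOn? A ⊤ R

    Ξ-witness? : ∀ A R → Dec (Ξ-witness A R)
    Ξ-witness? A R = InT? A R ×-dec wPos? α G A ⊤ R ×-dec InT? A R ×-dec
      all? Subset.anySubset? (λ C → ClosedNonempty? A R C →-dec wPos? α G A (A ∪ C) R)

    Ξ-witness-resp : ∀ {A R R′} → (∀ x y → R x y ≡ R′ x y) → Ξ-witness A R → Ξ-witness A R′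
    Ξ-witness-resp {A} {R} {R′} R≡R′ ((A⊆⊤ , equiv) , pos , _ , ξ) =
      (A⊆⊤ , equiv′) , transport {⊤} pos , (A⊆⊤ , equiv′) ,
      λ C (nonempty , C⊆ , closed) → transport {A ∪ C}
        (ξ C (nonempty , C⊆ , λ x y x∈C y∈ Rxy → closed x y x∈C y∈ (trans (sym (R≡R′ x y)) Rxy)))
      where
      agree : ∀ A X → AgreeOn A X R R′
      agree _ _ x y _ _ = R≡R′ x y
      equiv′ : IsEquivOn A ⊤ R′
      equiv′ = IsEquivOn-cong A ⊤ (agree A ⊤) equiv
      transport : ∀ {X} → wPos α G A X R → wPos α G A X R′
      transport {X} = subst₂ (WPos α) (vW-cong A X (agree A X)) (eW-cong A X (agree A X) G)

  Ξ? : ∀ A → Dec (∃ (Ξ-witness A))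
  Ξ? A = map′ (λ (rows , w) → rows→rel rows , w)
              (λ (R , w) → rel→rows R , Ξ-witness-resp (λ x y → sym (rows→rel∘rel→rows R x y)) w)
              (searchVec Subset.anySubset? n (Ξ-witness? A ∘ rows→rel))

claim1p16 : (α : IrrationalCut) {n : ℕ} (G : Graph n) (A : Subset n) →
    ((α , G) ⊢ A ≤s ⊤) ⇔
    ((A ≡ ⊤) ⊎
    (Σ (Fin n → Fin n → Bool) λ R →
    InT A ⊤ R × wPos α G A ⊤ R × InXi α G A ⊤ R))
claim1p16 α G A = mk⇔ forward backward
  where
  forward : (α , G) ⊢ A ≤s ⊤ → (A ≡ ⊤) ⊎ ∃ (Ξ-witness α G A)
  forward A≤s⊤ with Vec.≡-dec Bool._≟_ A ⊤
  ... | yes A≡⊤ = inj₁ A≡⊤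
  ... | no  A≢⊤ = inj₂ (decidable-stable (Ξ? α G A) (≤s⇒¬¬Ξ α G A≤s⊤ A≢⊤))
  backward : (A ≡ ⊤) ⊎ ∃ (Ξ-witness α G A) → (α , G) ⊢ A ≤s ⊤
  backward (inj₁ refl)             = Subset.⊆⊤ , λ (_ , ((⊤⊆A′ , _) , ⊤≢A′) , A′⊆⊤) →
                                       ⊤≢A′ (Subset.⊆-antisym ⊤⊆A′ A′⊆⊤)
  backward (inj₂ (_ , _ , _ , ξ)) = Ξ⇒≤s α G ξ
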